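{- Let $n\geq 4$. There is an order-preserving bijective map between the poset $(\mathcal{C}_{n-2,1,1},\leq)$ and the set $\mathcal{R}_n$ of row readings of elements of $\mathcal{C}_{n-2,1,1}$, ordered by $u\leq v$ iff $\ell(u)\leq\ell(v)$; namely the map $\tau\mapsto{}_{\tau}w$.
   Context: A recording row-strict tableau of shape $(n-2,1,1)$ is a filling of the Young diagram with rows of lengths $n-2,1,1$ (top to bottom) by $1,\dots,n$, each used once, with first row $m_1<\dots<m_{n-2}$, second row entry $b_1$ and third row entry $b_2$ with $b_1>b_2$; $\mathcal{C}_{n-2,1,1}$ is the set of these. For $\tau=(m_1,\dots,m_{n-2};b_1;b_2)$, $\tau'=(m'_1,\dots,m'_{n-2};b'_1;b'_2)$: $\tau\leq\tau'$ iff $m_i\geq m'_i$ for all $i$, $b_1\leq b'_1$ and $b_2\leq b'_2$. The row reading of $\tau$ is ${}_{\tau}w=[b_2,b_1,m_1,\dots,m_{n-2}]\in\mathfrak{S}_n$ (one-line notation; rows read from bottom to top, left to right). $\ell$ is the number of inversions. Order-preserving means $\tau\leq\tau'$ implies ${}_{\tau}w\leq{}_{\tau'}w$. -}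

module Defs where

open import Data.Nat using (ℕ; zero; suc; _+_; _∸_; _<_; _≤_; _≥_; _<ᵇ_)
open import Data.Bool using (if_then_else_)
open import Data.List using (List; []; _∷_; length; map; upTo)
open import Data.List.Relation.Unary.Linked using (Linked)
open import Data.List.Relation.Binary.Pointwise using (Pointwise)
open import Data.List.Relation.Binary.Permutation.Propositional using (_↭_)
open import Relation.Binary.PropositionalEquality using (_≡_)
open import Data.Product using (∃)

oneTo : ℕ → List ℕ
oneTo n = map suc (upTo n)

-- Row-strict tableau of shape (n-2,1,1) filled with 1..n:
-- first row m₁ < ... < m_{n-2}, second row b₁, third row b₂, with b₁ > b₂,
-- and every number 1..n used exactly once.
record Tableau (n : ℕ) : Set where
  field
    m      : List ℕ
    b₁     : ℕ
    b₂     : ℕ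
    len    : length m ≡ n ∸ 2
    incr   : Linked _<_ m
    b₂<b₁  : b₂ < b₁
    perm   : (b₂ ∷ b₁ ∷ m) ↭ oneTo n
open Tableau public

_≤T_ : ∀ {n} → Tableau n → Tableau n → Set
τ ≤T τ' = Pointwise _≥_ (m τ) (m τ') × (b₁ τ ≤ b₁ τ') × (b₂ τ ≤ b₂ τ')
  where open import Data.Product using (_×_)

rowReading : ∀ {n} → Tableau n → List ℕ
rowReading τ = b₂ τ ∷ b₁ τ ∷ m τ

countLess : ℕ → List ℕ → ℕ
countLess x [] = 0
countLess x (y ∷ ys) = (if y <ᵇ x then 1 else 0) + countLess x ys

inv : List ℕ → ℕ
inv [] = 0
inv (x ∷ xs) = countLess x xs + inv xs

Rn : ℕ → List ℕ → Set
Rn n w = ∃ λ (τ : Tableau n) → rowReading τ ≡ w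

_≤R_ : List ℕ → List ℕ → Set
u ≤R v = inv u ≤ inv v

-- The reading w = [b₂, b₁, m₁, …, m_{n-2}] has no inversions inside the increasing
-- tail m, b₂ < b₁ is one inversion, and the remaining ones are the letters of m
-- below b₂ and below b₁. Since w is a permutation of 1…n, the number of letters of w
-- below x is the number below x in 1…n, so 1 + ℓ(w) = #{k ≤ n | k < b₂} + #{k ≤ n | k < b₁}
-- (that is, ℓ(w) = b₁ + b₂ − 3). This is monotone in b₁ and b₂, and the order on
-- tableaux compares b₁ and b₂ in the same direction.
module Submission where

open import Defs
open import Data.Bool using (if_then_else_; true; false)
open import Data.Empty using (⊥-elim)
open import Data.List using (List; []; _∷_; map)
open import Data.List.Properties using (∷-injective)
open import Data.List.Relation.Unary.All using (All; []; _∷_)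
open import Data.List.Relation.Unary.Linked as Linked using (Linked; []; [-]; _∷_)
open import Data.List.Relation.Unary.Linked.Properties using (Linked⇒All)
open import Data.List.Relation.Binary.Permutation.Propositional using (_↭_)
open import Data.List.Relation.Binary.Permutation.Propositional.Properties using (map⁺)
open import Data.Nat using (ℕ; suc; _+_; _<_; _≤_; _≥_; _<ᵇ_; s≤s; s≤s⁻¹)
open import Data.Nat.ListAction using (sum)
open import Data.Nat.ListAction.Properties using (sum-↭)
open import Data.Nat.Properties
  using (<ᵇ⇒<; <⇒<ᵇ; ≤⇒≯; <-≤-trans; <⇒≤; ≤-refl; ≤-trans; +-mono-≤; +-suc; +-identityʳ; m≤n⇒m≤1+n; module ≤-Reasoning)
open import Data.Product using (_×_; ∃; _,_)
open import Relation.Binary.PropositionalEquality using (_≡_; refl; sym; trans; cong; cong₂; module ≡-Reasoning)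

countLess-∷-< : ∀ {x y} ys → y < x → countLess x (y ∷ ys) ≡ suc (countLess x ys)
countLess-∷-< {x} {y} ys y<x with y <ᵇ x | <⇒<ᵇ y<x
... | true | _ = refl

countLess-∷-≥ : ∀ {x y} ys → x ≤ y → countLess x (y ∷ ys) ≡ countLess x ys
countLess-∷-≥ {x} {y} ys x≤y with y <ᵇ x | <ᵇ⇒< y x
... | false | _   = refl
... | true  | y<x = ⊥-elim (≤⇒≯ x≤y (y<x _))

countLess-≡0 : ∀ {x ys} → All (x ≤_) ys → countLess x ys ≡ 0
countLess-≡0 []                      = refl
countLess-≡0 {ys = y ∷ ys} (x≤y ∷ xs≤) = trans (countLess-∷-≥ ys x≤y) (countLess-≡0 xs≤)

countLess-monoˡ-≤ : ∀ ys {x y} → x ≤ y → countLess x ys ≤ countLess y ys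
countLess-monoˡ-≤ []       _   = ≤-refl
countLess-monoˡ-≤ (z ∷ zs) {x} {y} x≤y with z <ᵇ x | <ᵇ⇒< z x | z <ᵇ y | <⇒<ᵇ {z} {y}
... | false | _   | false | _     = countLess-monoˡ-≤ zs x≤y
... | false | _   | true  | _     = m≤n⇒m≤1+n (countLess-monoˡ-≤ zs x≤y)
... | true  | z<x | false | z<ᵇy = ⊥-elim (z<ᵇy (<-≤-trans (z<x _) x≤y))
... | true  | _   | true  | _     = s≤s (countLess-monoˡ-≤ zs x≤y)

countLess≡sum : ∀ x ys → countLess x ys ≡ sum (map (λ y → if y <ᵇ x then 1 else 0) ys)
countLess≡sum x []       = refl
countLess≡sum x (y ∷ ys) = cong ((if y <ᵇ x then 1 else 0) +_) (countLess≡sum x ys)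

countLess-↭ : ∀ x {xs ys} → xs ↭ ys → countLess x xs ≡ countLess x ys
countLess-↭ x {xs} {ys} xs↭ys = begin
  countLess x xs                                  ≡⟨ countLess≡sum x xs ⟩
  sum (map (λ y → if y <ᵇ x then 1 else 0) xs)    ≡⟨ sum-↭ (map⁺ _ xs↭ys) ⟩
  sum (map (λ y → if y <ᵇ x then 1 else 0) ys)    ≡⟨ sym (countLess≡sum x ys) ⟩
  countLess x ys                                  ∎
  where open ≡-Reasoning

ascending⇒inv≡0 : ∀ {xs} → Linked _≤_ xs → inv xs ≡ 0
ascending⇒inv≡0 []  = refl
ascending⇒inv≡0 [-] = refl
ascending⇒inv≡0 (x≤y ∷ ys↑) =
  cong₂ _+_ (countLess-≡0 (Linked⇒All ≤-trans x≤y ys↑)) (ascending⇒inv≡0 ys↑)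

suc-inv-c∷b∷ascending : ∀ {c b ms} → c < b → Linked _<_ ms →
  suc (inv (c ∷ b ∷ ms)) ≡ countLess c (c ∷ b ∷ ms) + countLess b (c ∷ b ∷ ms)
suc-inv-c∷b∷ascending {c} {b} {ms} c<b ms↑ = begin
  suc (countLess c (b ∷ ms) + (countLess b ms + inv ms))
    ≡⟨ cong₂ (λ p q → suc (p + (countLess b ms + q)))
             (countLess-∷-≥ ms (<⇒≤ c<b)) (ascending⇒inv≡0 (Linked.map <⇒≤ ms↑)) ⟩
  suc (countLess c ms + (countLess b ms + 0))
    ≡⟨ cong (λ k → suc (countLess c ms + k)) (+-identityʳ _) ⟩
  suc (countLess c ms + countLess b ms)
    ≡⟨ sym (+-suc _ _) ⟩
  countLess c ms + suc (countLess b ms)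
    ≡⟨ sym (cong₂ _+_ countLess-c countLess-b) ⟩
  countLess c (c ∷ b ∷ ms) + countLess b (c ∷ b ∷ ms) ∎
  where
  open ≡-Reasoning
  countLess-c : countLess c (c ∷ b ∷ ms) ≡ countLess c ms
  countLess-c = trans (countLess-∷-≥ (b ∷ ms) ≤-refl) (countLess-∷-≥ ms (<⇒≤ c<b))
  countLess-b : countLess b (c ∷ b ∷ ms) ≡ suc (countLess b ms)
  countLess-b = trans (countLess-∷-< (b ∷ ms) c<b) (cong suc (countLess-∷-≥ ms ≤-refl))

suc-inv-rowReading : ∀ {n} (τ : Tableau n) →
  suc (inv (rowReading τ)) ≡ countLess (b₂ τ) (oneTo n) + countLess (b₁ τ) (oneTo n)
suc-inv-rowReading τ = trans (suc-inv-c∷b∷ascending (b₂<b₁ τ) (incr τ))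
  (cong₂ _+_ (countLess-↭ (b₂ τ) (perm τ)) (countLess-↭ (b₁ τ) (perm τ)))

rowReading-mono : ∀ {n} (τ τ' : Tableau n) → τ ≤T τ' → rowReading τ ≤R rowReading τ'
rowReading-mono {n} τ τ' (_ , b₁≤ , b₂≤) = s≤s⁻¹ (begin
  suc (inv (rowReading τ))                                ≡⟨ suc-inv-rowReading τ ⟩
  countLess (b₂ τ) (oneTo n) + countLess (b₁ τ) (oneTo n)
    ≤⟨ +-mono-≤ (countLess-monoˡ-≤ (oneTo n) b₂≤) (countLess-monoˡ-≤ (oneTo n) b₁≤) ⟩
  countLess (b₂ τ') (oneTo n) + countLess (b₁ τ') (oneTo n) ≡⟨ sym (suc-inv-rowReading τ') ⟩
  suc (inv (rowReading τ'))                               ∎)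
  where open ≤-Reasoning

rowReading-injective : ∀ {n} (τ τ' : Tableau n) → rowReading τ ≡ rowReading τ' →
  (m τ ≡ m τ') × (b₁ τ ≡ b₁ τ') × (b₂ τ ≡ b₂ τ')
rowReading-injective τ τ' eq with ∷-injective eq
... | b₂≡ , tail≡ with ∷-injective tail≡
... | b₁≡ , m≡ = m≡ , b₁≡ , b₂≡

lemma4p6 : (n : ℕ) → n ≥ 4 →
    ((τ τ' : Tableau n) → rowReading τ ≡ rowReading τ' →
        (m τ ≡ m τ') × (b₁ τ ≡ b₁ τ') × (b₂ τ ≡ b₂ τ'))
    × ((w : List ℕ) → Rn n w → ∃ λ (τ : Tableau n) → rowReading τ ≡ w)
    × ((τ τ' : Tableau n) → τ ≤T τ' → rowReading τ ≤R rowReading τ')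
lemma4p6 n _ = rowReading-injective , (λ _ w∈Rn → w∈Rn) , rowReading-mono
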